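{- Let $J_n=[2^n,2^{n+1})$ and for $A\subseteq\omega$ let $\widetilde{\mathcal R}(A)=\bigcup_{n\in A}J_n$. 1. There is an enumeration operator $W$ such that for every $A$ and every weak cofinite description $f$ of $A$, $W^{\mathrm{gra}(f)}$ is the graph of a dense description of $\widetilde{\mathcal R}(A)$; and there is an enumeration operator $V$ such that for every $A$ and every dense description $g$ of $\widetilde{\mathcal R}(A)$, $V^{\mathrm{gra}(g)}$ is the graph of a weak cofinite description of $A$. 2. There is a Turing functional $\Phi$ such that for every $A$ and every strong cofinite description $f$ of $A$, $\Phi^f$ is an effective dense description of $\widetilde{\mathcal R}(A)$; and there is a Turing functional $\Psi$ such that for every $A$ and every effective dense description $g$ of $\widetilde{\mathcal R}(A)$, $\Psi^g$ is a strong cofinite description of $A$.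
   Context: Sets are identified with characteristic functions. For $C\subseteq\omega$, $\rho_n(C)=|C\cap\{0,\dots,n-1\}|/n$ and $\rho(C)=\lim_n\rho_n(C)$ when it exists. A dense description of $g$ is a partial $d$ with $\rho(\{n:d(n)=g(n)\})=1$. A weak cofinite description of $g$ is a partial $d$ with $d(n)=g(n)$ for all but finitely many $n$. An effective dense description of $g$ is a total $d:\omega\to\omega\cup\{\square\}$ ($\square\notin\omega$) with $d(n)=g(n)$ whenever $d(n)\ne\square$ and $\rho(\{n:d(n)\ne\square\})=1$. A strong cofinite description of $g$ is such a total $d$ with $d(n)=g(n)$ whenever $d(n)\ne\square$ and $d(n)\ne\square$ for all but finitely many $n$. An enumeration operator is a c.e. set $W$ of pairs $(F,k)$, $F$ finite, with $W^Y=\{k:\exists(F,k)\in W,\,F\subseteq Y\}$. -}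

module Defs where

open import Data.Nat using (ℕ; zero; suc; _+_; _*_; _^_; _≤_; _<_; _%_; _/_)
open import Data.Nat.Logarithm using (⌊log₂_⌋)
open import Data.Bool using (Bool; true; false)
open import Data.Maybe using (Maybe; just; nothing)
open import Data.Fin using (Fin)
open import Data.Vec using (Vec; []; _∷_; lookup)
open import Data.List using (List; length)
open import Data.List.Relation.Unary.All using (All)
open import Data.List.Relation.Unary.Unique.Propositional using (Unique)
open import Data.Product using (Σ; ∃; _×_; _,_)
open import Data.Integer using (+_)
open import Data.Rational using (ℚ; _≤_; _-_; _<_; 0ℚ; 1ℚ)
open import Relation.Binary.PropositionalEquality using (_≡_; _≢_)
open import Relation.Nullary using (¬_)

SetΩ : Set
SetΩ = ℕ → Bool

χ : SetΩ → ℕ → ℕ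
χ A n with A n
... | true  = 1
... | false = 0

-- J_k = [2^k, 2^{k+1}), and R̃(A) = ⋃_{k ∈ A} J_k.
-- n ∈ J_k iff n ≥ 1 and k = ⌊log₂ n⌋ ; 0 lies in no J_k.

Rt : SetΩ → SetΩ
Rt A zero    = false
Rt A (suc n) = A ⌊log₂ suc n ⌋

AtLeast : (ℕ → Set) → ℕ → ℕ → Set
AtLeast C n ℓ = Σ (List ℕ) λ xs →
  Unique xs × All (λ x → x Data.Nat.< n) xs × All C xs × length xs ≡ ℓ

-- ρ(C) = 1, i.e. lim_n ρ_n(C) = 1 (as ρ_n(C) ≤ 1 always, this says:
-- for every ε > 0, eventually ρ_n(C) ≥ 1 - ε).
DensityOne : (ℕ → Set) → Set
DensityOne C = (ε : ℚ) → 0ℚ Data.Rational.< ε → Σ ℕ λ N → (n : ℕ) → N Data.Nat.≤ n →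
  Σ ℕ λ ℓ → AtLeast C (suc n) ℓ × (1ℚ - ε) Data.Rational.≤ ((+ ℓ) Data.Rational./ suc n)

record Partial : Set₁ where
  field
    rel        : ℕ → ℕ → Set
    functional : ∀ {n a b} → rel n a → rel n b → a ≡ b
open Partial public

tri : ℕ → ℕ
tri zero    = zero
tri (suc k) = suc k + tri k

pair : ℕ → ℕ → ℕ
pair n m = tri (n + m) + m

Gra : Partial → ℕ → Set
Gra d x = Σ ℕ λ n → Σ ℕ λ m → x ≡ pair n m × rel d n m

DenseDesc : Partial → (ℕ → ℕ) → Set
DenseDesc d g = DensityOne (λ n → rel d n (g n))

WeakCofDesc : Partial → (ℕ → ℕ) → Set
WeakCofDesc d g = Σ ℕ λ N → (n : ℕ) → N Data.Nat.≤ n → rel d n (g n)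

-- effective / strong cofinite descriptions: total d : ω → ω ∪ {□},
-- with □ represented by nothing.
EffDenseDesc : (ℕ → Maybe ℕ) → (ℕ → ℕ) → Set
EffDenseDesc d g = ((n : ℕ) → d n ≢ nothing → d n ≡ just (g n))
                 × DensityOne (λ n → d n ≢ nothing)

StrongCofDesc : (ℕ → Maybe ℕ) → (ℕ → ℕ) → Set
StrongCofDesc d g = ((n : ℕ) → d n ≢ nothing → d n ≡ just (g n))
                  × (Σ ℕ λ N → (n : ℕ) → N Data.Nat.≤ n → d n ≢ nothing)

-- Computability: μ-recursive codes, optionally with an oracle ℕ → ℕ.

data Code : Bool → ℕ → Set where
  zeroᶜ  : ∀ {o n} → Code o n
  sucᶜ   : ∀ {o} → Code o 1
  proj   : ∀ {o n} → Fin n → Code o n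
  comp   : ∀ {o m n} → Code o m → Vec (Code o n) m → Code o n
  prec   : ∀ {o n} → Code o n → Code o (suc (suc n)) → Code o (suc n)
  mu     : ∀ {o n} → Code o (suc n) → Code o n
  oracle : Code true 1

mutual
  data Eval (α : ℕ → ℕ) : ∀ {o n} → Code o n → Vec ℕ n → ℕ → Set where
    e-zero : ∀ {o n} {xs : Vec ℕ n} → Eval α (zeroᶜ {o}) xs 0
    e-suc  : ∀ {o x} → Eval α (sucᶜ {o}) (x ∷ []) (suc x)
    e-proj : ∀ {o n} {i : Fin n} {xs} → Eval α (proj {o} i) xs (lookup xs i)
    e-comp : ∀ {o m n} {f : Code o m} {gs : Vec (Code o n) m} {xs ys v} →
             EvalVec α gs xs ys → Eval α f ys v → Eval α (comp f gs) xs v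
    e-prec0 : ∀ {o n} {f : Code o n} {g : Code o (suc (suc n))} {xs v} →
              Eval α f xs v → Eval α (prec f g) (0 ∷ xs) v
    e-precS : ∀ {o n} {f : Code o n} {g : Code o (suc (suc n))} {y xs u v} →
              Eval α (prec f g) (y ∷ xs) u → Eval α g (y ∷ u ∷ xs) v →
              Eval α (prec f g) (suc y ∷ xs) v
    e-mu   : ∀ {o n} {f : Code o (suc n)} {xs y} →
             Eval α f (y ∷ xs) 0 →
             ((z : ℕ) → z Data.Nat.< y → Σ ℕ λ w → Eval α f (z ∷ xs) (suc w)) →
             Eval α (mu f) xs y
    e-oracle : ∀ {x} → Eval α oracle (x ∷ []) (α x)

  data EvalVec (α : ℕ → ℕ) : ∀ {o m n} → Vec (Code o n) m → Vec ℕ n → Vec ℕ m → Set where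
    [] : ∀ {o n} {xs : Vec ℕ n} → EvalVec α ([] {A = Code o n}) xs []
    _∷_ : ∀ {o m n} {g : Code o n} {gs : Vec (Code o n) m} {xs y ys} →
          Eval α g xs y → EvalVec α gs xs ys → EvalVec α (g ∷ gs) xs (y ∷ ys)

-- the c.e. set with index e : W_e = dom(φ_e)  (no oracle is consulted)
CE : Code false 1 → ℕ → Set
CE e x = Σ ℕ λ v → Eval (λ _ → 0) e (x ∷ []) v

-- canonical finite sets: D_u = {x : bit x of u is 1}
-- shift u x = ⌊u / 2^x⌋
shift : ℕ → ℕ → ℕ
shift u zero    = u
shift u (suc x) = shift (u / 2) x

InD : ℕ → ℕ → Set
InD u x = shift u x % 2 ≡ 1

-- enumeration operator W (a c.e. set of codes pair u k of pairs (D_u, k)):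
-- W^Y = {k : ∃ u, pair u k ∈ W and D_u ⊆ Y}
EnumOp : Code false 1 → (ℕ → Set) → ℕ → Set
EnumOp W Y k = Σ ℕ λ u → CE W (pair u k) × ((x : ℕ) → InD u x → Y x)

-- coding of ω ∪ {□} into ω for oracles/outputs of Turing functionals:
-- □ ↦ 0, m ↦ m + 1
enc : Maybe ℕ → ℕ
enc nothing  = 0
enc (just m) = suc m

Computes : Code true 1 → (ℕ → Maybe ℕ) → (ℕ → Maybe ℕ) → Set
Computes Φ f d = (n : ℕ) → Eval (λ x → enc (f x)) Φ (n ∷ []) (enc (d n))

-- A description of A becomes one of R̃(A) by answering at n what it answers at ⌊log₂ n⌋: if it
-- is correct from k = N on, the new one is correct for all n ≥ 2^N, a cofinite set, so of density
-- one. Conversely, since J k is half of [0, 2^(k+1)), a description of R̃(A) that is correct on a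
-- set of density one is, for all large k, correct on more than half of J k. So an effective dense
-- description has a non-□ value somewhere on J k, which a bounded search finds; and for a partial
-- dense description V enumerates ⟨k, v⟩ once finitely much of the graph shows the value v at more
-- than half of the points of J k. Two such majorities overlap, so this defines a partial function.

module Submission where

open import Defs
open import Data.Bool using (Bool; true; false)
open import Data.Empty using (⊥)
open import Data.Fin using () renaming (zero to fzero; suc to fsuc)
open import Data.Integer as ℤ using (-[1+_])
import Data.Integer.Properties as ℤₚ
open import Data.List using (List; []; _∷_; [_]; length; map; filter; applyUpTo)
open import Data.List.Membership.Propositional using (_∈_; _∉_)
open import Data.List.Membership.Propositional.Properties using (∈-map⁺; ∈-map⁻)
open import Data.List.Properties using (length-applyUpTo)
open import Data.List.Relation.Unary.All as All using (All; []; _∷_)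
import Data.List.Relation.Unary.All.Properties as All
open import Data.List.Relation.Unary.AllPairs using ([]; _∷_)
open import Data.List.Relation.Unary.Any using (here; there)
open import Data.List.Relation.Unary.Unique.Propositional using (Unique)
import Data.List.Relation.Unary.Unique.Propositional.Properties as Unique
open import Data.Maybe using (Maybe; just; nothing; _<∣>_)
open import Data.Maybe.Properties using (just-injective)
open import Data.Nat
open import Data.Nat.DivMod
open import Data.Nat.Induction using (<-rec)
open import Data.Nat.ListAction using (sum)
open import Data.Nat.Logarithm
open import Data.Nat.Properties
open import Data.List.Membership.DecPropositional _≟_ using (_∈?_)
open import Data.Nat.Tactic.RingSolver using (solve-∀)
open import Algebra.Properties.CommutativeSemigroup +-commutativeSemigroup using () renaming (interchange to +-interchange)
open import Data.Product using (Σ; ∃; _×_; _,_; proj₂)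
open import Data.Rational as ℚ using (ℚ; mkℚ; 0ℚ; 1ℚ; toℚᵘ)
import Data.Rational.Properties as ℚₚ
open import Data.Rational.Unnormalised as ℚᵘ using (ℚᵘ; mkℚᵘ; *≤*)
import Data.Rational.Unnormalised.Properties as ℚᵘₚ
open import Data.Sum using (inj₁; inj₂)
open import Data.Vec using (Vec; []; _∷_)
open import Function using (_∘_)
open import Function.Bundles using (_⇔_; mk⇔; Equivalence)
open import Relation.Binary using (tri<; tri≈; tri>)
open import Relation.Binary.PropositionalEquality hiding (J; [_])
open import Relation.Nullary using (Dec; yes; no; does; ¬?; contradiction)
open import Relation.Unary using (Decidable)

-- Binary logarithm and the intervals J k

2^⌊log₂n⌋≤n : ∀ n → 1 ≤ n → 2 ^ ⌊log₂ n ⌋ ≤ n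
2^⌊log₂n⌋≤n = <-rec (λ n → 1 ≤ n → 2 ^ ⌊log₂ n ⌋ ≤ n) bound
  where
  bound : ∀ n → (∀ {m} → m < n → 1 ≤ m → 2 ^ ⌊log₂ m ⌋ ≤ m) → 1 ≤ n → 2 ^ ⌊log₂ n ⌋ ≤ n
  bound 1 _ _ = ≤-refl
  bound n@(suc (suc m)) rec _ = begin
    2 ^ ⌊log₂ n ⌋              ≡⟨ cong (2 ^_) ⌊log₂n⌋≡1+⌊log₂h⌋ ⟩
    2 * 2 ^ ⌊log₂ h ⌋          ≤⟨ *-monoʳ-≤ 2 (rec (s<s (s<s (⌊n/2⌋≤n m))) (s≤s z≤n)) ⟩
    h + (h + 0)                ≤⟨ +-monoʳ-≤ h (≤-trans (≤-reflexive (+-identityʳ h)) (⌊n/2⌋≤⌈n/2⌉ n)) ⟩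
    h + ⌈ n /2⌉                ≡⟨ ⌊n/2⌋+⌈n/2⌉≡n n ⟩
    n                          ∎
    where
    open ≤-Reasoning
    h = ⌊ n /2⌋
    ⌊log₂n⌋≡1+⌊log₂h⌋ : ⌊log₂ n ⌋ ≡ suc ⌊log₂ h ⌋
    ⌊log₂n⌋≡1+⌊log₂h⌋ = begin-equality
      ⌊log₂ n ⌋             ≡⟨ m∸n+n≡m (⌊log₂⌋-mono-≤ {2} {n} (s≤s (s≤s z≤n))) ⟨
      ⌊log₂ n ⌋ ∸ 1 + 1     ≡⟨ +-comm _ 1 ⟩
      suc (⌊log₂ n ⌋ ∸ 1)   ≡⟨ cong suc (⌊log₂⌊n/2⌋⌋≡⌊log₂n⌋∸1 n) ⟨
      suc ⌊log₂ h ⌋         ∎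

n<2^[1+⌊log₂n⌋] : ∀ n → n < 2 ^ suc ⌊log₂ n ⌋
n<2^[1+⌊log₂n⌋] n with n <? 2 ^ suc ⌊log₂ n ⌋
... | yes n<2^[1+L] = n<2^[1+L]
... | no  n≮2^[1+L] = contradiction (⌊log₂⌋-mono-≤ (≮⇒≥ n≮2^[1+L])) λ 1+L≤L →
  n≮n ⌊log₂ n ⌋ (subst (_≤ ⌊log₂ n ⌋) (⌊log₂[2^n]⌋≡n (suc ⌊log₂ n ⌋)) 1+L≤L)

2^k≤n⇒k≤⌊log₂n⌋ : ∀ {k n} → 2 ^ k ≤ n → k ≤ ⌊log₂ n ⌋
2^k≤n⇒k≤⌊log₂n⌋ {k} 2^k≤n = subst (_≤ _) (⌊log₂[2^n]⌋≡n k) (⌊log₂⌋-mono-≤ 2^k≤n)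

J : ℕ → ℕ → Set
J k x = 2 ^ k ≤ x × x < 2 ^ k + 2 ^ k

J⇒⌊log₂⌋≡ : ∀ {k x} → J k x → ⌊log₂ x ⌋ ≡ k
J⇒⌊log₂⌋≡ {k} {x} (2^k≤x , x<2^[1+k]) = ≤-antisym ⌊log₂x⌋≤k (2^k≤n⇒k≤⌊log₂n⌋ 2^k≤x)
  where
  ⌊log₂x⌋≤k : ⌊log₂ x ⌋ ≤ k
  ⌊log₂x⌋≤k with ⌊log₂ x ⌋ ≤? k
  ... | yes L≤k = L≤k
  ... | no  L≰k = contradiction (≤-trans (^-monoʳ-≤ 2 (≰⇒> L≰k)) (2^⌊log₂n⌋≤n x (≤-trans (m^n>0 2 k) 2^k≤x)))
                    (<⇒≱ (<-≤-trans x<2^[1+k] (≤-reflexive (cong (2 ^ k +_) (sym (+-identityʳ (2 ^ k)))))))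

χ-Rt-J : ∀ A {k x} → J k x → χ (Rt A) x ≡ χ A k
χ-Rt-J A {k} {zero}  (2^k≤0 , _) = contradiction (≤-trans (m^n>0 2 k) 2^k≤0) λ ()
χ-Rt-J A {k} {suc x} J[x] = cong (χ A) (J⇒⌊log₂⌋≡ J[x])

x₀ : ∀ {o n} → Code o (suc n)
x₀ = proj fzero

x₁ : ∀ {o n} → Code o (suc (suc n))
x₁ = proj (fsuc fzero)

x₂ : ∀ {o n} → Code o (suc (suc (suc n)))
x₂ = proj (fsuc (fsuc fzero))

x₃ : ∀ {o n} → Code o (suc (suc (suc (suc n))))
x₃ = proj (fsuc (fsuc (fsuc fzero)))

x₄ : ∀ {o n} → Code o (suc (suc (suc (suc (suc n)))))
x₄ = proj (fsuc (fsuc (fsuc (fsuc fzero))))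

module _ {α : ℕ → ℕ} where

  e-comp₁ : ∀ {o n} {f : Code o 1} {g : Code o n} {xs a v} →
            Eval α g xs a → Eval α f (a ∷ []) v → Eval α (comp f (g ∷ [])) xs v
  e-comp₁ g↓ f↓ = e-comp (g↓ ∷ []) f↓

  e-comp₂ : ∀ {o n} {f : Code o 2} {g h : Code o n} {xs a b v} →
            Eval α g xs a → Eval α h xs b → Eval α f (a ∷ b ∷ []) v →
            Eval α (comp f (g ∷ h ∷ [])) xs v
  e-comp₂ g↓ h↓ f↓ = e-comp (g↓ ∷ h↓ ∷ []) f↓

  e-mu-least : ∀ {o n} {f : Code o (suc n)} {xs} (F : ℕ → ℕ) →
               (∀ z → Eval α f (z ∷ xs) (F z)) →
               ∀ y → F y ≡ 0 → (∀ z → z < y → 0 < F z) → Eval α (mu f) xs y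
  e-mu-least {f = f} {xs} F f↓ y Fy≡0 F>0 = e-mu (subst (Eval α f (y ∷ xs)) Fy≡0 (f↓ y)) earlier
    where
    earlier : ∀ z → z < y → ∃ λ w → Eval α f (z ∷ xs) (suc w)
    earlier z z<y with F z | f↓ z | F>0 z z<y
    ... | suc w | fz↓ | _ = w , fz↓

  mutual
    Eval-functional : ∀ {o n} {c : Code o n} {xs a b} → Eval α c xs a → Eval α c xs b → a ≡ b
    Eval-functional e-zero e-zero = refl
    Eval-functional e-suc e-suc = refl
    Eval-functional e-proj e-proj = refl
    Eval-functional (e-comp gs↓ f↓) (e-comp gs↓′ f↓′) with EvalVec-functional gs↓ gs↓′
    ... | refl = Eval-functional f↓ f↓′
    Eval-functional (e-prec0 f↓) (e-prec0 f↓′) = Eval-functional f↓ f↓′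
    Eval-functional (e-precS r↓ g↓) (e-precS r↓′ g↓′) with Eval-functional r↓ r↓′
    ... | refl = Eval-functional g↓ g↓′
    Eval-functional (e-mu {y = y} f↓ below) (e-mu {y = y′} f↓′ below′) with <-cmp y y′
    ... | tri< y<y′ _ _ = contradiction (Eval-functional f↓ (proj₂ (below′ y y<y′))) λ ()
    ... | tri≈ _ y≡y′ _ = y≡y′
    ... | tri> _ _ y′<y = contradiction (Eval-functional f↓′ (proj₂ (below y′ y′<y))) λ ()
    Eval-functional e-oracle e-oracle = refl

    EvalVec-functional : ∀ {o m n} {gs : Vec (Code o n) m} {xs ys ys′} →
                         EvalVec α gs xs ys → EvalVec α gs xs ys′ → ys ≡ ys′
    EvalVec-functional [] [] = refl
    EvalVec-functional (g↓ ∷ gs↓) (g↓′ ∷ gs↓′) = cong₂ _∷_ (Eval-functional g↓ g↓′) (EvalVec-functional gs↓ gs↓′)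

predᶜ : ∀ {o} → Code o 1
predᶜ = prec zeroᶜ x₀

flipped-monusᶜ : ∀ {o} → Code o 2
flipped-monusᶜ = prec x₀ (comp predᶜ (x₁ ∷ []))

monusᶜ : ∀ {o} → Code o 2
monusᶜ = comp flipped-monusᶜ (x₁ ∷ x₀ ∷ [])

addᶜ : ∀ {o} → Code o 2
addᶜ = prec x₀ (comp sucᶜ (x₁ ∷ []))

oneᶜ : ∀ {o n} → Code o n
oneᶜ = comp sucᶜ (zeroᶜ ∷ [])

triᶜ : ∀ {o} → Code o 1
triᶜ = prec zeroᶜ (comp addᶜ (comp sucᶜ (x₀ ∷ []) ∷ x₁ ∷ []))

pairᶜ : ∀ {o} → Code o 2
pairᶜ = comp addᶜ (comp triᶜ (comp addᶜ (x₀ ∷ x₁ ∷ []) ∷ []) ∷ x₁ ∷ [])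

pow2ᶜ : ∀ {o} → Code o 1
pow2ᶜ = prec oneᶜ (comp addᶜ (x₁ ∷ x₁ ∷ []))

module _ {α : ℕ → ℕ} {o : Bool} where

  eval-predᶜ : ∀ x → Eval α (predᶜ {o}) (x ∷ []) (pred x)
  eval-predᶜ zero    = e-prec0 e-zero
  eval-predᶜ (suc x) = e-precS (eval-predᶜ x) e-proj

  eval-flipped-monusᶜ : ∀ y x → Eval α (flipped-monusᶜ {o}) (y ∷ x ∷ []) (x ∸ y)
  eval-flipped-monusᶜ zero    x = e-prec0 e-proj
  eval-flipped-monusᶜ (suc y) x = e-precS (eval-flipped-monusᶜ y x)
    (subst (Eval α _ _) (pred[m∸n]≡m∸[1+n] x y) (e-comp₁ e-proj (eval-predᶜ (x ∸ y))))

  eval-monusᶜ : ∀ x y → Eval α (monusᶜ {o}) (x ∷ y ∷ []) (x ∸ y)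
  eval-monusᶜ x y = e-comp₂ e-proj e-proj (eval-flipped-monusᶜ y x)

  eval-addᶜ : ∀ x y → Eval α (addᶜ {o}) (x ∷ y ∷ []) (x + y)
  eval-addᶜ zero    y = e-prec0 e-proj
  eval-addᶜ (suc x) y = e-precS (eval-addᶜ x y) (e-comp₁ e-proj e-suc)

  eval-oneᶜ : ∀ {n} {xs : Vec ℕ n} → Eval α (oneᶜ {o}) xs 1
  eval-oneᶜ = e-comp₁ e-zero e-suc

  eval-triᶜ : ∀ k → Eval α (triᶜ {o}) (k ∷ []) (tri k)
  eval-triᶜ zero    = e-prec0 e-zero
  eval-triᶜ (suc k) = e-precS (eval-triᶜ k) (e-comp₂ (e-comp₁ e-proj e-suc) e-proj (eval-addᶜ (suc k) (tri k)))

  eval-pairᶜ : ∀ n m → Eval α (pairᶜ {o}) (n ∷ m ∷ []) (pair n m)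
  eval-pairᶜ n m = e-comp₂ (e-comp₁ (e-comp₂ e-proj e-proj (eval-addᶜ n m)) (eval-triᶜ (n + m))) e-proj (eval-addᶜ _ m)

  eval-pow2ᶜ : ∀ k → Eval α (pow2ᶜ {o}) (k ∷ []) (2 ^ k)
  eval-pow2ᶜ zero    = e-prec0 eval-oneᶜ
  eval-pow2ᶜ (suc k) = e-precS (eval-pow2ᶜ k)
    (subst (Eval α _ _) (cong (2 ^ k +_) (sym (+-identityʳ (2 ^ k)))) (e-comp₂ e-proj e-proj (eval-addᶜ (2 ^ k) (2 ^ k))))

tri-mono-≤ : ∀ {a b} → a ≤ b → tri a ≤ tri b
tri-mono-≤ {b = zero}  z≤n = z≤n
tri-mono-≤ {a} {suc b} a≤1+b with m≤n⇒m<n∨m≡n a≤1+b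
... | inj₁ (s≤s a≤b) = ≤-trans (tri-mono-≤ a≤b) (m≤n+m (tri b) (suc b))
... | inj₂ refl      = ≤-refl

-- the diagonal n + m of pair n m is the least z with pair n m < tri (z + 1)
diagᶜ : ∀ {o} → Code o 1
diagᶜ = mu (comp monusᶜ (comp sucᶜ (x₁ ∷ []) ∷ comp triᶜ (comp sucᶜ (x₀ ∷ []) ∷ []) ∷ []))

sndᶜ : ∀ {o} → Code o 1
sndᶜ = comp monusᶜ (x₀ ∷ comp triᶜ (comp diagᶜ (x₀ ∷ []) ∷ []) ∷ [])

fstᶜ : ∀ {o} → Code o 1
fstᶜ = comp monusᶜ (comp diagᶜ (x₀ ∷ []) ∷ sndᶜ ∷ [])

-- ⌊u/2⌋ is the least t with u < 2t + 2
halfᶜ : ∀ {o} → Code o 1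
halfᶜ = mu (comp monusᶜ (comp sucᶜ (x₁ ∷ []) ∷ comp addᶜ (comp sucᶜ (x₀ ∷ []) ∷ comp sucᶜ (x₀ ∷ []) ∷ []) ∷ []))

parityᶜ : ∀ {o} → Code o 1
parityᶜ = comp monusᶜ (x₀ ∷ comp addᶜ (comp halfᶜ (x₀ ∷ []) ∷ comp halfᶜ (x₀ ∷ []) ∷ []) ∷ [])

shiftᶜ : ∀ {o} → Code o 2
shiftᶜ = prec x₀ (comp halfᶜ (x₁ ∷ []))

bitᶜ : ∀ {o} → Code o 2
bitᶜ = comp parityᶜ (comp shiftᶜ (x₁ ∷ x₀ ∷ []) ∷ [])

log₂ᶜ : ∀ {o} → Code o 1
log₂ᶜ = mu (comp monusᶜ (comp sucᶜ (x₁ ∷ []) ∷ comp pow2ᶜ (comp sucᶜ (x₀ ∷ []) ∷ []) ∷ []))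

bit : ℕ → ℕ → ℕ
bit u p = shift u p % 2

shift[1+p] : ∀ u p → shift u (suc p) ≡ shift u p / 2
shift[1+p] u zero    = refl
shift[1+p] u (suc p) = shift[1+p] (u / 2) p

m*2≡m+m : ∀ m → m * 2 ≡ m + m
m*2≡m+m m = trans (*-comm m 2) (cong (m +_) (+-identityʳ m))

m≡m%2+[m/2+m/2] : ∀ m → m ≡ m % 2 + (m / 2 + m / 2)
m≡m%2+[m/2+m/2] m = trans (m≡m%n+[m/n]*n m 2) (cong (m % 2 +_) (m*2≡m+m (m / 2)))

module _ {α : ℕ → ℕ} {o : Bool} where

  eval-diagᶜ : ∀ n m → Eval α (diagᶜ {o}) (pair n m ∷ []) (n + m)
  eval-diagᶜ n m = e-mu-least (λ z → suc (pair n m) ∸ tri (suc z))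
    (λ z → e-comp₂ (e-comp₁ e-proj e-suc) (e-comp₁ (e-comp₁ e-proj e-suc) (eval-triᶜ (suc z))) (eval-monusᶜ _ _))
    (n + m) (m≤n⇒m∸n≡0 pair<tri[1+s]) λ z z<s → m<n⇒0<n∸m (s≤s (≤-trans (tri-mono-≤ z<s) (m≤m+n _ m)))
    where
    pair<tri[1+s] : pair n m < tri (suc (n + m))
    pair<tri[1+s] = s≤s (subst (pair n m ≤_) (+-comm (tri (n + m)) (n + m)) (+-monoʳ-≤ (tri (n + m)) (m≤n+m m n)))

  eval-sndᶜ : ∀ n m → Eval α (sndᶜ {o}) (pair n m ∷ []) m
  eval-sndᶜ n m = e-comp₂ e-proj (e-comp₁ (e-comp₁ e-proj (eval-diagᶜ n m)) (eval-triᶜ (n + m)))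
    (subst (Eval α _ _) (m+n∸m≡n (tri (n + m)) m) (eval-monusᶜ _ _))

  eval-fstᶜ : ∀ n m → Eval α (fstᶜ {o}) (pair n m ∷ []) n
  eval-fstᶜ n m = e-comp₂ (e-comp₁ e-proj (eval-diagᶜ n m)) (eval-sndᶜ n m)
    (subst (Eval α _ _) (m+n∸n≡m n m) (eval-monusᶜ _ _))

  eval-halfᶜ : ∀ u → Eval α (halfᶜ {o}) (u ∷ []) (u / 2)
  eval-halfᶜ u = e-mu-least (λ t → suc u ∸ (suc t + suc t))
    (λ t → e-comp₂ (e-comp₁ e-proj e-suc) (e-comp₂ (e-comp₁ e-proj e-suc) (e-comp₁ e-proj e-suc) (eval-addᶜ _ _)) (eval-monusᶜ _ _))
    h (m≤n⇒m∸n≡0 (s≤s u≤h+[1+h])) λ t t<h → m<n⇒0<n∸m (s≤s (2t+2≤u t t<h))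
    where
    open ≤-Reasoning
    h = u / 2
    u≤h+[1+h] : u ≤ h + suc h
    u≤h+[1+h] = begin
      u                  ≡⟨ m≡m%2+[m/2+m/2] u ⟩
      u % 2 + (h + h)    ≤⟨ +-monoˡ-≤ (h + h) (≤-pred (m%n<n u 2)) ⟩
      suc (h + h)        ≡⟨ +-suc h h ⟨
      h + suc h          ∎
    2t+2≤u : ∀ t → t < h → suc t + suc t ≤ u
    2t+2≤u t t<h = begin
      suc t + suc t      ≤⟨ +-mono-≤ t<h t<h ⟩
      h + h              ≤⟨ m≤n+m (h + h) (u % 2) ⟩
      u % 2 + (h + h)    ≡⟨ m≡m%2+[m/2+m/2] u ⟨
      u                  ∎

  eval-parityᶜ : ∀ u → Eval α (parityᶜ {o}) (u ∷ []) (u % 2)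
  eval-parityᶜ u = e-comp₂ e-proj (e-comp₂ (e-comp₁ e-proj (eval-halfᶜ u)) (e-comp₁ e-proj (eval-halfᶜ u)) (eval-addᶜ _ _))
    (subst (Eval α _ _) u∸2h≡u%2 (eval-monusᶜ _ _))
    where
    u∸2h≡u%2 : u ∸ (u / 2 + u / 2) ≡ u % 2
    u∸2h≡u%2 = trans (cong (_∸ (u / 2 + u / 2)) (m≡m%2+[m/2+m/2] u)) (m+n∸n≡m (u % 2) (u / 2 + u / 2))

  eval-shiftᶜ : ∀ p u → Eval α (shiftᶜ {o}) (p ∷ u ∷ []) (shift u p)
  eval-shiftᶜ zero    u = e-prec0 e-proj
  eval-shiftᶜ (suc p) u = e-precS (eval-shiftᶜ p u)
    (subst (Eval α _ _) (sym (shift[1+p] u p)) (e-comp₁ e-proj (eval-halfᶜ (shift u p))))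

  eval-bitᶜ : ∀ u p → Eval α (bitᶜ {o}) (u ∷ p ∷ []) (bit u p)
  eval-bitᶜ u p = e-comp₁ (e-comp₂ e-proj e-proj (eval-shiftᶜ p u)) (eval-parityᶜ _)

  eval-log₂ᶜ : ∀ n → Eval α (log₂ᶜ {o}) (n ∷ []) ⌊log₂ n ⌋
  eval-log₂ᶜ n = e-mu-least (λ k → suc n ∸ 2 ^ suc k)
    (λ k → e-comp₂ (e-comp₁ e-proj e-suc) (e-comp₁ (e-comp₁ e-proj e-suc) (eval-pow2ᶜ (suc k))) (eval-monusᶜ _ _))
    ⌊log₂ n ⌋ (m≤n⇒m∸n≡0 (n<2^[1+⌊log₂n⌋] n)) (earlier n)
    where
    earlier : ∀ n z → z < ⌊log₂ n ⌋ → 0 < suc n ∸ 2 ^ suc z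
    earlier zero    z ()
    earlier (suc n) z z<L = m<n⇒0<n∸m (s≤s (≤-trans (^-monoʳ-≤ 2 z<L) (2^⌊log₂n⌋≤n (suc n) (s≤s z≤n))))

noOracle : ℕ → ℕ
noOracle _ = 0

-- pairing is injective because the unpairing programs compute functions
pair-injective : ∀ {n m n′ m′} → pair n m ≡ pair n′ m′ → n ≡ n′ × m ≡ m′
pair-injective {n} {m} {n′} {m′} eq =
  Eval-functional (eval-fstᶜ n m) (subst (λ y → Eval noOracle (fstᶜ {false}) (y ∷ []) n′) (sym eq) (eval-fstᶜ n′ m′)) ,
  Eval-functional (eval-sndᶜ n m) (subst (λ y → Eval noOracle (sndᶜ {false}) (y ∷ []) m′) (sym eq) (eval-sndᶜ n′ m′))

pair-surjective : ∀ y → ∃ λ n → ∃ λ m → y ≡ pair n m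
pair-surjective zero = 0 , 0 , refl
pair-surjective (suc y) with pair-surjective y
... | suc n , m , refl = n , suc m , (begin
  suc (tri (suc n + m) + m)   ≡⟨ +-suc (tri (suc n + m)) m ⟨
  tri (suc n + m) + suc m     ≡⟨ cong (λ s → tri s + suc m) (+-suc n m) ⟨
  tri (n + suc m) + suc m     ∎)
  where open ≡-Reasoning
... | zero  , m , refl = suc m , 0 , (begin
  suc (tri m + m)             ≡⟨ cong suc (+-comm (tri m) m) ⟩
  tri (suc m)                 ≡⟨ cong tri (+-identityʳ (suc m)) ⟨
  tri (suc m + 0)             ≡⟨ +-identityʳ _ ⟨
  tri (suc m + 0) + 0         ∎)
  where open ≡-Reasoning

bit≤1 : ∀ u p → bit u p ≤ 1
bit≤1 u p = ≤-pred (m%n<n (shift u p) 2)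

1∸bit≡0⇒InD : ∀ u p → 1 ∸ bit u p ≡ 0 → InD u p
1∸bit≡0⇒InD u p 1∸bit≡0 = ≤-antisym (bit≤1 u p) (m∸n≡0⇒m≤n 1∸bit≡0)

bitsFrom : SetΩ → ℕ → ℕ → ℕ
bitsFrom P i zero    = 0
bitsFrom P i (suc M) = χ P i + bitsFrom P (suc i) M * 2

bitsFrom-shift : ∀ P i M → bitsFrom P i (suc M) / 2 ≡ bitsFrom P (suc i) M
bitsFrom-shift P i M with P i
... | false = m*n/n≡m (bitsFrom P (suc i) M) 2
... | true  = trans (+-distrib-/ 1 (bitsFrom P (suc i) M * 2) (subst (λ r → 1 + r < 2) (sym (m*n%n≡0 (bitsFrom P (suc i) M) 2)) ≤-refl))
                    (m*n/n≡m (bitsFrom P (suc i) M) 2)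

bitsFrom-parity : ∀ P i M → bitsFrom P i (suc M) % 2 ≡ χ P i
bitsFrom-parity P i M with P i
... | false = [m+kn]%n≡m%n 0 (bitsFrom P (suc i) M) 2
... | true  = [m+kn]%n≡m%n 1 (bitsFrom P (suc i) M) 2

shift0≡0 : ∀ p → shift 0 p ≡ 0
shift0≡0 zero    = refl
shift0≡0 (suc p) = shift0≡0 p

bit-bitsFrom : ∀ P i M {p} → p < M → bit (bitsFrom P i M) p ≡ χ P (i + p)
bit-bitsFrom P i (suc M) {zero}  _ = trans (bitsFrom-parity P i M) (cong (χ P) (sym (+-identityʳ i)))
bit-bitsFrom P i (suc M) {suc p} (s≤s p<M) = begin
  shift (bitsFrom P i (suc M) / 2) p % 2   ≡⟨ cong (λ u → shift u p % 2) (bitsFrom-shift P i M) ⟩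
  bit (bitsFrom P (suc i) M) p             ≡⟨ bit-bitsFrom P (suc i) M p<M ⟩
  χ P (suc i + p)                          ≡⟨ cong (χ P) (+-suc i p) ⟨
  χ P (i + suc p)                          ∎
  where open ≡-Reasoning

shift-bitsFrom : ∀ P i M {p} → M ≤ p → shift (bitsFrom P i M) p ≡ 0
shift-bitsFrom P i zero    {p}     _         = shift0≡0 p
shift-bitsFrom P i (suc M) {suc p} (s≤s M≤p) =
  trans (cong (λ u → shift u p) (bitsFrom-shift P i M)) (shift-bitsFrom P (suc i) M M≤p)

∈⇒≤sum : ∀ {y ys} → y ∈ ys → y ≤ sum ys
∈⇒≤sum {ys = y ∷ ys} (here refl) = m≤m+n y (sum ys)
∈⇒≤sum {ys = z ∷ ys} (there y∈ys) = ≤-trans (∈⇒≤sum y∈ys) (m≤n+m (sum ys) z)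

⌜_⌝ : List ℕ → ℕ
⌜ ys ⌝ = bitsFrom (λ y → does (y ∈? ys)) 0 (suc (sum ys))

χ-does : ∀ {A : Set} (a? : Dec A) → χ (λ _ → does a?) 0 ≡ 1 → A
χ-does (yes a) _ = a

InD⌜⌝⁻ : ∀ ys {y} → InD ⌜ ys ⌝ y → y ∈ ys
InD⌜⌝⁻ ys {y} y∈D with y <? suc (sum ys)
... | yes y<M = χ-does (y ∈? ys) (trans (sym (bit-bitsFrom _ 0 (suc (sum ys)) y<M)) y∈D)
... | no  y≮M = contradiction (trans (sym (cong (_% 2) (shift-bitsFrom _ 0 (suc (sum ys)) (≮⇒≥ y≮M)))) y∈D) λ ()

InD⌜⌝⁺ : ∀ ys {y} → y ∈ ys → InD ⌜ ys ⌝ y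
InD⌜⌝⁺ ys {y} y∈ys with y ∈? ys | bit-bitsFrom (λ y → does (y ∈? ys)) 0 (suc (sum ys)) (s≤s (∈⇒≤sum y∈ys))
... | yes _    | bit≡1 = bit≡1
... | no  y∉ys | _     = contradiction y∈ys y∉ys

-- Counting and density

sumBelow : (ℕ → ℕ) → ℕ → ℕ
sumBelow f zero    = 0
sumBelow f (suc m) = sumBelow f m + f m

sumBelow-+ : ∀ f g m → sumBelow f m + sumBelow g m ≡ sumBelow (λ i → f i + g i) m
sumBelow-+ f g zero    = refl
sumBelow-+ f g (suc m) = begin
  (F + f m) + (G + g m)   ≡⟨ +-interchange F (f m) G (g m) ⟩
  (F + G) + (f m + g m)   ≡⟨ cong (_+ (f m + g m)) (sumBelow-+ f g m) ⟩
  sumBelow (λ i → f i + g i) m + (f m + g m) ∎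
  where
  open ≡-Reasoning
  F = sumBelow f m
  G = sumBelow g m

sumBelow-mono-≤ : ∀ {f g} m → (∀ i → f i ≤ g i) → sumBelow f m ≤ sumBelow g m
sumBelow-mono-≤ zero    f≤g = z≤n
sumBelow-mono-≤ (suc m) f≤g = +-mono-≤ (sumBelow-mono-≤ m f≤g) (f≤g m)

sumBelow-≤-length : ∀ {f} m → (∀ i → f i ≤ 1) → sumBelow f m ≤ m
sumBelow-≤-length zero    f≤1 = z≤n
sumBelow-≤-length {f} (suc m) f≤1 = subst (sumBelow f m + f m ≤_) (+-comm m 1) (+-mono-≤ (sumBelow-≤-length m f≤1) (f≤1 m))

term≤sumBelow : ∀ f {j m} → j < m → f j ≤ sumBelow f m
term≤sumBelow f {j} {suc m} j<1+m with m≤n⇒m<n∨m≡n (≤-pred j<1+m)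
... | inj₁ j<m  = ≤-trans (term≤sumBelow f j<m) (m≤m+n _ (f m))
... | inj₂ refl = m≤n+m (f j) _

𝟙 : ∀ {A : Set} → Dec A → ℕ
𝟙 (yes _) = 1
𝟙 (no _)  = 0

𝟙≤1 : ∀ {A : Set} (a? : Dec A) → 𝟙 a? ≤ 1
𝟙≤1 (yes _) = ≤-refl
𝟙≤1 (no _)  = z≤n

𝟙[≡]+𝟙[∈]≤𝟙[∈∷] : ∀ {x xs} → x ∉ xs → ∀ y → 𝟙 (y ≟ x) + 𝟙 (y ∈? xs) ≤ 𝟙 (y ∈? (x ∷ xs))
𝟙[≡]+𝟙[∈]≤𝟙[∈∷] {x} {xs} x∉xs y with y ≟ x | y ∈? xs | y ∈? (x ∷ xs)
... | yes refl | yes x∈xs | _         = contradiction x∈xs x∉xs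
... | yes refl | no _     | yes _     = ≤-refl
... | yes refl | no _     | no x∉x∷xs = contradiction (here refl) x∉x∷xs
... | no _     | yes _    | yes _     = ≤-refl
... | no _     | yes y∈xs | no y∉x∷xs = contradiction (there y∈xs) y∉x∷xs
... | no _     | no _     | _         = z≤n

length≤sumBelow-𝟙∈ : ∀ a m {xs} → Unique xs → All (λ x → a ≤ x × x < a + m) xs →
               length xs ≤ sumBelow (λ i → 𝟙 (a + i ∈? xs)) m
length≤sumBelow-𝟙∈ a m {[]}     _               _                 = z≤n
length≤sumBelow-𝟙∈ a m {x ∷ xs} (x∉xs ∷ unique) ((a≤x , x<a+m) ∷ inside) = begin
  1 + length xs
    ≤⟨ +-mono-≤ hit (length≤sumBelow-𝟙∈ a m unique inside) ⟩
  sumBelow (λ i → 𝟙 (a + i ≟ x)) m + sumBelow (λ i → 𝟙 (a + i ∈? xs)) m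
    ≡⟨ sumBelow-+ _ _ m ⟩
  sumBelow (λ i → 𝟙 (a + i ≟ x) + 𝟙 (a + i ∈? xs)) m
    ≤⟨ sumBelow-mono-≤ m (λ i → 𝟙[≡]+𝟙[∈]≤𝟙[∈∷] (All.All¬⇒¬Any x∉xs) (a + i)) ⟩
  sumBelow (λ i → 𝟙 (a + i ∈? (x ∷ xs))) m ∎
  where
  open ≤-Reasoning
  hit : 1 ≤ sumBelow (λ i → 𝟙 (a + i ≟ x)) m
  hit with a + (x ∸ a) ≟ x | term≤sumBelow (λ i → 𝟙 (a + i ≟ x)) (+-cancelˡ-< a _ _ (subst (_< a + m) (sym (m+[n∸m]≡n a≤x)) x<a+m))
  ... | yes _ | 1≤sum = 1≤sum
  ... | no ≢x | _     = contradiction (m+[n∸m]≡n a≤x) ≢x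

1-ε≤ℓ/[1+n]⇔ : ∀ ε ℓ n → (1ℚ ℚ.- ε ℚ.≤ ℤ.+ ℓ ℚ./ suc n) ⇔ (ℚᵘ.1ℚᵘ ℚᵘ.- toℚᵘ ε ℚᵘ.≤ mkℚᵘ (ℤ.+ ℓ) n)
1-ε≤ℓ/[1+n]⇔ ε ℓ n = mk⇔
  (λ le → ℚᵘₚ.≤-respʳ-≃ ℓ/[1+n]≃ (ℚᵘₚ.≤-respˡ-≃ 1-ε≃ (ℚₚ.toℚᵘ-mono-≤ le)))
  (λ le → ℚₚ.toℚᵘ-cancel-≤ (ℚᵘₚ.≤-respʳ-≃ (ℚᵘₚ.≃-sym ℓ/[1+n]≃) (ℚᵘₚ.≤-respˡ-≃ (ℚᵘₚ.≃-sym 1-ε≃) le)))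
  where
  1-ε≃ : toℚᵘ (1ℚ ℚ.- ε) ℚᵘ.≃ ℚᵘ.1ℚᵘ ℚᵘ.- toℚᵘ ε
  1-ε≃ = ℚᵘₚ.≃-trans (ℚₚ.toℚᵘ-homo-+ 1ℚ (ℚ.- ε)) (ℚᵘₚ.+-congʳ ℚᵘ.1ℚᵘ (ℚₚ.toℚᵘ-homo‿- ε))
  ℓ/[1+n]≃ : toℚᵘ (ℤ.+ ℓ ℚ./ suc n) ℚᵘ.≃ mkℚᵘ (ℤ.+ ℓ) n
  ℓ/[1+n]≃ = ℚₚ.toℚᵘ-fromℚᵘ (mkℚᵘ (ℤ.+ ℓ) n)

-- ε = (p+1)/(d+1) in lowest terms, so 1 - ε ≤ d/(d+1)
1-ε≤ℓ/[1+n]-sufficient : ∀ ε → 0ℚ ℚ.< ε → ∃ λ d → ∀ ℓ n → d * suc n ≤ ℓ * suc d → 1ℚ ℚ.- ε ℚ.≤ ℤ.+ ℓ ℚ./ suc n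
1-ε≤ℓ/[1+n]-sufficient (mkℚ (ℤ.+ 0) d _) (ℚ.*<* (ℤ.+<+ ()))
1-ε≤ℓ/[1+n]-sufficient (mkℚ -[1+ p ] d _) (ℚ.*<* ())
1-ε≤ℓ/[1+n]-sufficient ε@(mkℚ (ℤ.+ suc p) d _) _ = d , λ ℓ n d[1+n]≤ℓ[1+d] →
  Equivalence.from (1-ε≤ℓ/[1+n]⇔ ε ℓ n) (*≤* (begin
    ℚᵘ.numerator 1-ε ℤ.* ℤ.+ suc n   ≤⟨ ℤₚ.*-monoʳ-≤-nonNeg (ℤ.+ suc n) numerator≤d ⟩
    ℤ.+ d ℤ.* ℤ.+ suc n              ≡⟨ ℤₚ.pos-* d (suc n) ⟨
    ℤ.+ (d * suc n)                  ≤⟨ ℤ.+≤+ d[1+n]≤ℓ[1+d] ⟩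
    ℤ.+ (ℓ * suc d)                  ≡⟨ ℤₚ.pos-* ℓ (suc d) ⟩
    ℤ.+ ℓ ℤ.* ℤ.+ suc d              ≡⟨ cong (λ e → ℤ.+ ℓ ℤ.* ℤ.+ suc e) (+-identityʳ d) ⟨
    ℤ.+ ℓ ℤ.* ℚᵘ.denominator 1-ε     ∎))
  where
  open ℤₚ.≤-Reasoning
  1-ε = ℚᵘ.1ℚᵘ ℚᵘ.- toℚᵘ ε
  numerator≤d : ℚᵘ.numerator 1-ε ℤ.≤ ℤ.+ d
  numerator≤d = subst (ℤ._≤ ℤ.+ d)
    (sym (trans (cong₂ ℤ._+_ (ℤₚ.*-identityˡ (ℤ.+ suc d)) (ℤₚ.*-identityʳ -[1+ p ])) (ℤₚ.[1+m]⊖[1+n]≡m⊖n d p)))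
    (ℤₚ.m⊖n≤m d p)

⅛ : ℚ
⅛ = ℤ.+ 1 ℚ./ 8

1-⅛≤ℓ/[1+n]⇒ : ∀ ℓ n → 1ℚ ℚ.- ⅛ ℚ.≤ ℤ.+ ℓ ℚ./ suc n → 7 * suc n ≤ ℓ * 8
1-⅛≤ℓ/[1+n]⇒ ℓ n le with Equivalence.to (1-ε≤ℓ/[1+n]⇔ ⅛ ℓ n) le
... | *≤* 7[1+n]≤8ℓ = ℤₚ.drop‿+≤+ (subst₂ ℤ._≤_ (sym (ℤₚ.pos-* 7 (suc n))) (sym (ℤₚ.pos-* ℓ 8)) 7[1+n]≤8ℓ)

atLeast-tail : ∀ {C : ℕ → Set} M n → (∀ x → M ≤ x → C x) → M ≤ n → AtLeast C n (n ∸ M)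
atLeast-tail M n C-cofinite M≤n =
  applyUpTo (M +_) (n ∸ M) ,
  Unique.applyUpTo⁺₁ (M +_) (n ∸ M) (λ i<j _ → <⇒≢ (+-monoʳ-< M i<j)) ,
  All.applyUpTo⁺₁ (M +_) (n ∸ M) (λ i<n∸M → <-≤-trans (+-monoʳ-< M i<n∸M) (≤-reflexive (m+[n∸m]≡n M≤n))) ,
  All.applyUpTo⁺₂ (M +_) (n ∸ M) (λ i → C-cofinite (M + i) (m≤m+n M i)) ,
  length-applyUpTo (M +_) (n ∸ M)

tail-proportion : ∀ M d n → M * suc d ≤ n → d * suc n ≤ (suc n ∸ M) * suc d
tail-proportion M d n M[1+d]≤n = begin
  d * suc n                   ≡⟨ *-comm d (suc n) ⟩
  suc n * d                   ≡⟨ m+n∸m≡n (suc n) (suc n * d) ⟨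
  suc n + suc n * d ∸ suc n   ≡⟨ cong (_∸ suc n) (*-suc (suc n) d) ⟨
  suc n * suc d ∸ suc n       ≤⟨ ∸-monoʳ-≤ (suc n * suc d) (≤-trans M[1+d]≤n (n≤1+n n)) ⟩
  suc n * suc d ∸ M * suc d   ≡⟨ *-distribʳ-∸ (suc d) (suc n) M ⟨
  (suc n ∸ M) * suc d         ∎
  where open ≤-Reasoning

cofinite⇒densityOne : ∀ {C : ℕ → Set} M → (∀ n → M ≤ n → C n) → DensityOne C
cofinite⇒densityOne M C-cofinite ε 0<ε =
  let d , sufficient = 1-ε≤ℓ/[1+n]-sufficient ε 0<ε
  in M * suc d , λ n M[1+d]≤n →
       suc n ∸ M ,
       atLeast-tail M (suc n) C-cofinite (≤-trans (m≤m*n M (suc d)) (m≤n⇒m≤1+n M[1+d]≤n)) ,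
       sufficient (suc n ∸ M) n (tail-proportion M d n M[1+d]≤n)

n<2^n : ∀ n → n < 2 ^ n
n<2^n zero    = s≤s z≤n
n<2^n (suc n) = begin-strict
  suc n            ≤⟨ n<2^n n ⟩
  2 ^ n            <⟨ m<m+n (2 ^ n) (≤-trans (m^n>0 2 n) (m≤m+n (2 ^ n) 0)) ⟩
  2 ^ n + (2 ^ n + 0) ∎
  where open ≤-Reasoning

unique-below⇒length≤ : ∀ {m xs} → Unique xs → All (_< m) xs → length xs ≤ m
unique-below⇒length≤ {m} {xs} unique below =
  ≤-trans (length≤sumBelow-𝟙∈ 0 m unique (All.map (z≤n ,_) below)) (sumBelow-≤-length m (λ i → 𝟙≤1 (i ∈? xs)))

length≡length-filter+length-filter-¬ : ∀ {P : ℕ → Set} (P? : Decidable P) xs →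
  length xs ≡ length (filter P? xs) + length (filter (¬? ∘ P?) xs)
length≡length-filter+length-filter-¬ P? [] = refl
length≡length-filter+length-filter-¬ P? (x ∷ xs) with P? x
... | yes _ = cong suc (length≡length-filter+length-filter-¬ P? xs)
... | no  _ = trans (cong suc (length≡length-filter+length-filter-¬ P? xs)) (sym (+-suc _ _))

-- at least 7/8 of [0, 2K), at most K of it below K: more than K/2 lies in [K, 2K)
more-than-half : ∀ K h l → 0 < K → l ≤ K → 7 * (K + K) ≤ (h + l) * 8 → K < h + h
more-than-half K h l 0<K l≤K 14K≤8[h+l] = ≰⇒> λ h+h≤K → <⇒≱ (begin-strict
  (h + l) * 8            ≡⟨ distribute h l ⟩
  (h + h) * 4 + l * 8    ≤⟨ +-mono-≤ (*-monoˡ-≤ 4 h+h≤K) (*-monoˡ-≤ 8 l≤K) ⟩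
  K * 4 + K * 8          ≡⟨ twelve K ⟩
  K * 12 + 0             <⟨ +-monoʳ-< (K * 12) (≤-trans (s≤s z≤n) (*-monoˡ-≤ 2 0<K)) ⟩
  K * 12 + K * 2         ≡⟨ fourteen K ⟨
  7 * (K + K)            ∎) 14K≤8[h+l]
  where
  open ≤-Reasoning
  distribute : ∀ h l → (h + l) * 8 ≡ (h + h) * 4 + l * 8
  distribute = solve-∀
  twelve : ∀ K → K * 4 + K * 8 ≡ K * 12 + 0
  twelve = solve-∀
  fourteen : ∀ K → 7 * (K + K) ≡ K * 12 + K * 2
  fourteen = solve-∀

Majority : (ℕ → Set) → ℕ → Set
Majority C k = Σ (List ℕ) λ xs → Unique xs × All (J k) xs × All C xs × 2 ^ k < length xs + length xs

upper-half-majority : ∀ {C : ℕ → Set} k {xs} → Unique xs → All (_< 2 ^ k + 2 ^ k) xs → All C xs →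
                      7 * (2 ^ k + 2 ^ k) ≤ length xs * 8 → Majority C k
upper-half-majority {C} k {xs} unique below all-C 14K≤8ℓ =
  upper , Unique.filter⁺ (K ≤?_) unique ,
  All.zip (All.all-filter (K ≤?_) xs , All.filter⁺ (K ≤?_) below) ,
  All.filter⁺ (K ≤?_) all-C ,
  more-than-half K (length upper) (length lower) (m^n>0 2 k) length-lower≤K
    (subst (λ l → 7 * (K + K) ≤ l * 8) (length≡length-filter+length-filter-¬ (K ≤?_) xs) 14K≤8ℓ)
  where
  K = 2 ^ k
  upper = filter (K ≤?_) xs
  lower = filter (¬? ∘ (K ≤?_)) xs
  length-lower≤K : length lower ≤ K
  length-lower≤K = unique-below⇒length≤ (Unique.filter⁺ (¬? ∘ (K ≤?_)) unique)
                     (All.map ≰⇒> (All.all-filter (¬? ∘ (K ≤?_)) xs))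

-- apply density one with ε = ⅛ to the initial segment [0, 2^(k+1))
densityOne⇒majority : ∀ {C : ℕ → Set} → DensityOne C → ∃ λ N → ∀ k → N ≤ k → Majority C k
densityOne⇒majority dense with dense ⅛ (ℚ.*<* (ℤ.+<+ (s≤s z≤n)))
... | N , eventually = N , majority
  where
  majority : ∀ k → N ≤ k → Majority _ k
  majority k N≤k with eventually (2 ^ suc k ∸ 1) (≤-trans N≤k (∸-monoˡ-≤ 1 (<⇒≤ (n<2^n (suc k)))))
  ... | ℓ , (xs , unique , below , all-C , refl) , 1-⅛≤ =
    upper-half-majority k unique (All.map (λ x< → <-≤-trans x< (≤-reflexive 1+[2^[1+k]∸1]≡2^k+2^k)) below) all-C
      (subst (λ s → 7 * s ≤ length xs * 8) 1+[2^[1+k]∸1]≡2^k+2^k (1-⅛≤ℓ/[1+n]⇒ (length xs) _ 1-⅛≤))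
    where
    1+[2^[1+k]∸1]≡2^k+2^k : suc (2 ^ suc k ∸ 1) ≡ 2 ^ k + 2 ^ k
    1+[2^[1+k]∸1]≡2^k+2^k = trans (m+[n∸m]≡n (m^n>0 2 (suc k))) (cong (2 ^ k +_) (+-identityʳ (2 ^ k)))

-- Turing functionals

-- as in R̃(A): the value f k is spread over J k, and 0 (which lies in no J k) gets b
spread : ∀ {b} {B : Set b} → B → (ℕ → B) → ℕ → B
spread b f zero    = b
spread b f (suc n) = f ⌊log₂ suc n ⌋

Sound : (ℕ → Maybe ℕ) → (ℕ → ℕ) → Set
Sound d g = ∀ n → d n ≢ nothing → d n ≡ just (g n)

Sound⇒values : ∀ {d g n v} → Sound d g → d n ≡ just v → v ≡ g n
Sound⇒values {d} {n = n} d-sound dn≡v with d n | d-sound n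
... | just _ | sound = just-injective (trans (sym dn≡v) (sound λ ()))

values⇒Sound : ∀ {d g} → (∀ {n v} → d n ≡ just v → v ≡ g n) → Sound d g
values⇒Sound {d} values n defined with d n in dn
... | just v  = cong just (values dn)
... | nothing = contradiction refl defined

Φᶜ : Code true 1
Φᶜ = prec zeroᶜ (comp oracle (comp log₂ᶜ (comp sucᶜ (x₀ ∷ []) ∷ []) ∷ []))

eval-Φᶜ : ∀ f n → Eval (enc ∘ f) Φᶜ (n ∷ []) (enc (spread nothing f n))
eval-Φᶜ f zero    = e-prec0 e-zero
eval-Φᶜ f (suc n) = e-precS (eval-Φᶜ f n) (e-comp₁ (e-comp₁ (e-comp₁ e-proj e-suc) (eval-log₂ᶜ (suc n))) e-oracle)

StrongCofDesc⇒EffDenseDesc : ∀ A f → StrongCofDesc f (χ A) → EffDenseDesc (spread nothing f) (χ (Rt A))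
StrongCofDesc⇒EffDenseDesc A f (correct , N , defined) = spread-sound , cofinite⇒densityOne (2 ^ N) spread-defined
  where
  spread-sound : Sound (spread nothing f) (χ (Rt A))
  spread-sound zero    undefined = contradiction refl undefined
  spread-sound (suc n) ≢nothing  = correct ⌊log₂ suc n ⌋ ≢nothing
  spread-defined : ∀ n → 2 ^ N ≤ n → spread nothing f n ≢ nothing
  spread-defined zero    2^N≤0   = contradiction (≤-trans (m^n>0 2 N) 2^N≤0) λ ()
  spread-defined (suc n) 2^N≤1+n = defined ⌊log₂ suc n ⌋ (2^k≤n⇒k≤⌊log₂n⌋ 2^N≤1+n)

_orElse_ : ℕ → ℕ → ℕ
zero  orElse b = b
suc a orElse b = suc a

enc-<∣> : ∀ x y → enc (x <∣> y) ≡ enc x orElse enc y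
enc-<∣> nothing  y = refl
enc-<∣> (just _) y = refl

orElseᶜ : ∀ {o} → Code o 2
orElseᶜ = prec x₀ (comp sucᶜ (x₀ ∷ []))

eval-orElseᶜ : ∀ {α o} a b → Eval α (orElseᶜ {o}) (a ∷ b ∷ []) (a orElse b)
eval-orElseᶜ zero    b = e-prec0 e-proj
eval-orElseᶜ (suc a) b = e-precS (eval-orElseᶜ a b) (e-comp₁ e-proj e-suc)

scan : (ℕ → Maybe ℕ) → ℕ → ℕ → Maybe ℕ
scan g k zero    = nothing
scan g k (suc i) = scan g k i <∣> g (2 ^ k + i)

scanᶜ : Code true 2
scanᶜ = prec zeroᶜ (comp orElseᶜ (x₁ ∷ comp oracle (comp addᶜ (comp pow2ᶜ (x₂ ∷ []) ∷ x₀ ∷ []) ∷ []) ∷ []))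

Ψᶜ : Code true 1
Ψᶜ = comp scanᶜ (comp pow2ᶜ (x₀ ∷ []) ∷ x₀ ∷ [])

eval-scanᶜ : ∀ g i k → Eval (enc ∘ g) scanᶜ (i ∷ k ∷ []) (enc (scan g k i))
eval-scanᶜ g zero    k = e-prec0 e-zero
eval-scanᶜ g (suc i) k = e-precS (eval-scanᶜ g i k)
  (subst (Eval _ _ _) (sym (enc-<∣> (scan g k i) (g (2 ^ k + i))))
    (e-comp₂ e-proj (e-comp₁ (e-comp₂ (e-comp₁ e-proj (eval-pow2ᶜ k)) e-proj (eval-addᶜ _ _)) e-oracle) (eval-orElseᶜ _ _)))

eval-Ψᶜ : ∀ g k → Eval (enc ∘ g) Ψᶜ (k ∷ []) (enc (scan g k (2 ^ k)))
eval-Ψᶜ g k = e-comp₂ (e-comp₁ e-proj (eval-pow2ᶜ k)) e-proj (eval-scanᶜ g (2 ^ k) k)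

scan-correct : ∀ A {g} → Sound g (χ (Rt A)) → ∀ {k i v} → i ≤ 2 ^ k → scan g k i ≡ just v → v ≡ χ A k
scan-correct A {g} g-sound {k} {suc i} i<2^k found-v with scan g k i in found
... | just _  = scan-correct A g-sound (<⇒≤ i<2^k) (trans found found-v)
... | nothing = trans (Sound⇒values g-sound found-v) (χ-Rt-J A (m≤m+n _ i , +-monoʳ-< (2 ^ k) i<2^k))

scan-complete : ∀ g {k i j} → g (2 ^ k + i) ≢ nothing → i < j → scan g k j ≢ nothing
scan-complete g {k} {i} {suc j} g-defined i<1+j with m≤n⇒m<n∨m≡n (≤-pred i<1+j) | scan g k j in found
... | _         | just _  = λ ()
... | inj₁ i<j  | nothing = contradiction found (scan-complete g g-defined i<j)
... | inj₂ refl | nothing = g-defined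

scan-finds : ∀ g {k x} → J k x → g x ≢ nothing → scan g k (2 ^ k) ≢ nothing
scan-finds g {k} {x} (2^k≤x , x<2^k+2^k) g-defined = scan-complete g
  (subst (λ y → g y ≢ nothing) (sym (m+[n∸m]≡n 2^k≤x)) g-defined)
  (+-cancelˡ-< (2 ^ k) _ _ (subst (_< 2 ^ k + 2 ^ k) (sym (m+[n∸m]≡n 2^k≤x)) x<2^k+2^k))

Majority⇒witness : ∀ {C k} → Majority C k → ∃ λ x → J k x × C x
Majority⇒witness (x ∷ _ , _ , J[x] ∷ _ , Cx ∷ _ , _) = x , J[x] , Cx

EffDenseDesc⇒StrongCofDesc : ∀ A g → EffDenseDesc g (χ (Rt A)) → StrongCofDesc (λ k → scan g k (2 ^ k)) (χ A)
EffDenseDesc⇒StrongCofDesc A g (g-sound , dense) =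
  let N , majority = densityOne⇒majority dense
  in values⇒Sound (scan-correct A g-sound ≤-refl) , N , λ k N≤k →
       let x , J[x] , g-defined = Majority⇒witness {k = k} (majority k N≤k) in scan-finds g {k} J[x] g-defined

-- Enumeration operators

fst∘sndᶜ : ∀ {o} → Code o 1
fst∘sndᶜ = comp fstᶜ (sndᶜ ∷ [])

snd∘sndᶜ : ∀ {o} → Code o 1
snd∘sndᶜ = comp sndᶜ (sndᶜ ∷ [])

module _ {α : ℕ → ℕ} {o : Bool} where

  eval-fst∘sndᶜ : ∀ u n m → Eval α (fst∘sndᶜ {o}) (pair u (pair n m) ∷ []) n
  eval-fst∘sndᶜ u n m = e-comp₁ (eval-sndᶜ u (pair n m)) (eval-fstᶜ n m)

  eval-snd∘sndᶜ : ∀ u n m → Eval α (snd∘sndᶜ {o}) (pair u (pair n m) ∷ []) m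
  eval-snd∘sndᶜ u n m = e-comp₁ (eval-sndᶜ u (pair n m)) (eval-sndᶜ n m)

zerosᶜ : Code false 1 → Code false 1
zerosᶜ c = mu (comp c (x₁ ∷ []))

CE-zerosᶜ : ∀ c y → CE (zerosᶜ c) y ⇔ Eval noOracle c (y ∷ []) 0
CE-zerosᶜ c y = mk⇔ (λ { (_ , e-mu (e-comp (e-proj ∷ []) c↓) _) → c↓ })
                    (λ c↓ → 0 , e-mu-least (λ _ → 0) (λ _ → e-comp₁ e-proj c↓) 0 refl λ _ ())

⊆Gra⇒rel : ∀ d {u n m} → (∀ y → InD u y → Gra d y) → InD u (pair n m) → rel d n m
⊆Gra⇒rel d {u} {n} {m} D⊆Gra n,m∈D with D⊆Gra (pair n m) n,m∈D
... | n′ , m′ , eq , r with pair-injective {n} {m} {n′} {m′} eq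
... | refl , refl = r

spread-functional : ∀ f {n a b} → spread (λ _ → ⊥) (rel f) n a → spread (λ _ → ⊥) (rel f) n b → a ≡ b
spread-functional f {suc n} = functional f

spreadᴾ : Partial → Partial
spreadᴾ f = record { rel = spread (λ _ → ⊥) (rel f) ; functional = λ {n} → spread-functional f {n} }

-- on ⟨u, ⟨n, m⟩⟩ it vanishes iff n ≥ 1 and ⟨⌊log₂ n⌋, m⟩ ∈ D u
wᶜ : Code false 1
wᶜ = comp addᶜ (comp monusᶜ (oneᶜ ∷ fst∘sndᶜ ∷ []) ∷
                comp monusᶜ (oneᶜ ∷ comp bitᶜ (fstᶜ ∷ comp pairᶜ (comp log₂ᶜ (fst∘sndᶜ ∷ []) ∷ snd∘sndᶜ ∷ []) ∷ []) ∷ []) ∷ [])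

eval-wᶜ : ∀ u n m → Eval noOracle wᶜ (pair u (pair n m) ∷ []) ((1 ∸ n) + (1 ∸ bit u (pair ⌊log₂ n ⌋ m)))
eval-wᶜ u n m = e-comp₂ (e-comp₂ eval-oneᶜ (eval-fst∘sndᶜ u n m) (eval-monusᶜ 1 n))
  (e-comp₂ eval-oneᶜ (e-comp₂ (eval-fstᶜ u _) (e-comp₂ (e-comp₁ (eval-fst∘sndᶜ u n m) (eval-log₂ᶜ n)) (eval-snd∘sndᶜ u n m) (eval-pairᶜ _ _)) (eval-bitᶜ _ _)) (eval-monusᶜ _ _))
  (eval-addᶜ _ _)

Wᶜ : Code false 1
Wᶜ = zerosᶜ wᶜ

EnumOp-Wᶜ : ∀ f x → EnumOp Wᶜ (Gra f) x ⇔ Gra (spreadᴾ f) x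
EnumOp-Wᶜ f x = mk⇔ to from
  where
  to : EnumOp Wᶜ (Gra f) x → Gra (spreadᴾ f) x
  to (u , u,x∈W , D⊆Gra) with pair-surjective x
  ... | n , m , refl with Eval-functional (eval-wᶜ u n m) (Equivalence.to (CE-zerosᶜ wᶜ _) u,x∈W)
  ... | vanishes with n
  ...   | zero  = contradiction vanishes λ ()
  ...   | suc n = suc n , m , refl , ⊆Gra⇒rel f D⊆Gra (1∸bit≡0⇒InD u (pair ⌊log₂ suc n ⌋ m) (m+n≡0⇒n≡0 (1 ∸ suc n) vanishes))
  from : Gra (spreadᴾ f) x → EnumOp Wᶜ (Gra f) x
  from (suc n , m , refl , r) = ⌜ [ k,m ] ⌝ , Equivalence.from (CE-zerosᶜ wᶜ _) (subst (Eval noOracle wᶜ _) vanishes (eval-wᶜ ⌜ [ k,m ] ⌝ (suc n) m)) , D⊆Gra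
    where
    k,m = pair ⌊log₂ suc n ⌋ m
    vanishes : (1 ∸ suc n) + (1 ∸ bit ⌜ [ k,m ] ⌝ k,m) ≡ 0
    vanishes = cong₂ _+_ (0∸n≡0 n) (cong (1 ∸_) (InD⌜⌝⁺ [ k,m ] (here refl)))
    D⊆Gra : ∀ y → InD ⌜ [ k,m ] ⌝ y → Gra f y
    D⊆Gra y y∈D with InD⌜⌝⁻ [ k,m ] {y} y∈D
    ... | here y≡k,m = ⌊log₂ suc n ⌋ , m , y≡k,m , r

WeakCofDesc⇒DenseDesc : ∀ A f → WeakCofDesc f (χ A) → DenseDesc (spreadᴾ f) (χ (Rt A))
WeakCofDesc⇒DenseDesc A f (N , described) = cofinite⇒densityOne (2 ^ N) described′
  where
  described′ : ∀ n → 2 ^ N ≤ n → spread (λ _ → ⊥) (rel f) n (χ (Rt A) n)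
  described′ zero    2^N≤0   = contradiction (≤-trans (m^n>0 2 N) 2^N≤0) λ ()
  described′ (suc n) 2^N≤1+n = described ⌊log₂ suc n ⌋ (2^k≤n⇒k≤⌊log₂n⌋ 2^N≤1+n)

votes : ℕ → ℕ → ℕ → ℕ → ℕ
votes u k v i = sumBelow (λ j → bit u (pair (2 ^ k + j) v)) i

votesᶜ : ∀ {o} → Code o 4
votesᶜ = prec zeroᶜ (comp addᶜ (x₁ ∷ comp bitᶜ (x₂ ∷ comp pairᶜ (comp addᶜ (comp pow2ᶜ (x₃ ∷ []) ∷ x₀ ∷ []) ∷ x₄ ∷ []) ∷ []) ∷ []))

eval-votesᶜ : ∀ {α o} i u k v → Eval α (votesᶜ {o}) (i ∷ u ∷ k ∷ v ∷ []) (votes u k v i)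
eval-votesᶜ zero    u k v = e-prec0 e-zero
eval-votesᶜ (suc i) u k v = e-precS (eval-votesᶜ i u k v)
  (e-comp₂ e-proj (e-comp₂ e-proj (e-comp₂ (e-comp₂ (e-comp₁ e-proj (eval-pow2ᶜ k)) e-proj (eval-addᶜ _ _)) e-proj (eval-pairᶜ _ _)) (eval-bitᶜ _ _)) (eval-addᶜ _ _))

-- on ⟨u, ⟨k, v⟩⟩ it vanishes iff 2^k < 2 · votes u k v (2^k)
vᶜ : Code false 1
vᶜ = comp monusᶜ (comp sucᶜ (comp pow2ᶜ (fst∘sndᶜ ∷ []) ∷ []) ∷ comp addᶜ (allVotes ∷ allVotes ∷ []) ∷ [])
  where
  allVotes : Code false 1
  allVotes = comp votesᶜ (comp pow2ᶜ (fst∘sndᶜ ∷ []) ∷ fstᶜ ∷ fst∘sndᶜ ∷ snd∘sndᶜ ∷ [])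

eval-vᶜ : ∀ u k v → let c = votes u k v (2 ^ k) in Eval noOracle vᶜ (pair u (pair k v) ∷ []) (suc (2 ^ k) ∸ (c + c))
eval-vᶜ u k v = e-comp₂ (e-comp₁ (e-comp₁ (eval-fst∘sndᶜ u k v) (eval-pow2ᶜ k)) e-suc) (e-comp₂ allVotes allVotes (eval-addᶜ _ _)) (eval-monusᶜ _ _)
  where
  allVotes = e-comp (e-comp₁ (eval-fst∘sndᶜ u k v) (eval-pow2ᶜ k) ∷ eval-fstᶜ u _ ∷ eval-fst∘sndᶜ u k v ∷ eval-snd∘sndᶜ u k v ∷ [])
                    (eval-votesᶜ (2 ^ k) u k v)

Vᶜ : Code false 1
Vᶜ = zerosᶜ vᶜ

Elected : Partial → ℕ → ℕ → Set
Elected g k v = ∃ λ u → (∀ y → InD u y → Gra g y) × 2 ^ k < votes u k v (2 ^ k) + votes u k v (2 ^ k)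

-- both bits set would make g take both values a and b at n
single-vote : ∀ g {u u′ a b} → a ≢ b → (∀ y → InD u y → Gra g y) → (∀ y → InD u′ y → Gra g y) →
              ∀ n → bit u (pair n a) + bit u′ (pair n b) ≤ 1
single-vote g {u} {u′} {a} {b} a≢b D⊆Gra D′⊆Gra n
  with bit u (pair n a) in ba | bit u′ (pair n b) in bb | bit≤1 u (pair n a) | bit≤1 u′ (pair n b)
... | 0    | _    | _      | bb≤1   = bb≤1
... | 1    | 0    | _      | _      = ≤-refl
... | 1    | 1    | _      | _      = contradiction (functional g (⊆Gra⇒rel g {n = n} D⊆Gra ba) (⊆Gra⇒rel g {n = n} D′⊆Gra bb)) a≢b
... | 1    | 2+ _ | _      | s≤s ()
... | 2+ _ | _    | s≤s () | _

Elected-functional : ∀ g {k a b} → Elected g k a → Elected g k b → a ≡ b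
Elected-functional g {k} {a} {b} (u , D⊆Gra , K<2c) (u′ , D′⊆Gra , K<2c′) with a ≟ b
... | yes a≡b = a≡b
... | no  a≢b = contradiction (+-mono-≤ c+c′≤K c+c′≤K) (<⇒≱ (begin-strict
  K + K                  <⟨ +-mono-< K<2c K<2c′ ⟩
  (c + c) + (c′ + c′)    ≡⟨ +-interchange c c c′ c′ ⟩
  (c + c′) + (c + c′)    ∎))
  where
  open ≤-Reasoning
  K  = 2 ^ k
  c  = votes u k a K
  c′ = votes u′ k b K
  c+c′≤K : c + c′ ≤ K
  c+c′≤K = ≤-trans (≤-reflexive (sumBelow-+ _ _ K)) (sumBelow-≤-length K (λ j → single-vote g a≢b D⊆Gra D′⊆Gra (K + j)))

electionᴾ : Partial → Partial
electionᴾ g = record { rel = Elected g ; functional = λ {k} → Elected-functional g {k} }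

EnumOp-Vᶜ : ∀ g x → EnumOp Vᶜ (Gra g) x ⇔ Gra (electionᴾ g) x
EnumOp-Vᶜ g x = mk⇔ to from
  where
  to : EnumOp Vᶜ (Gra g) x → Gra (electionᴾ g) x
  to (u , u,x∈V , D⊆Gra) with pair-surjective x
  ... | k , v , refl = k , v , refl , u , D⊆Gra ,
    m∸n≡0⇒m≤n (Eval-functional (eval-vᶜ u k v) (Equivalence.to (CE-zerosᶜ vᶜ _) u,x∈V))
  from : Gra (electionᴾ g) x → EnumOp Vᶜ (Gra g) x
  from (k , v , refl , u , D⊆Gra , K<2c) =
    u , Equivalence.from (CE-zerosᶜ vᶜ _) (subst (Eval noOracle vᶜ _) (m≤n⇒m∸n≡0 K<2c) (eval-vᶜ u k v)) , D⊆Gra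

-- D u is the set of ballots ⟨n, χ A k⟩ cast by a majority of J k
Majority⇒Elected : ∀ A g k → Majority (λ n → rel g n (χ (Rt A) n)) k → Elected g k (χ A k)
Majority⇒Elected A g k (xs , unique , inJ , described , majority) =
  ⌜ ballots ⌝ , D⊆Gra , <-≤-trans majority (+-mono-≤ length≤votes length≤votes)
  where
  K = 2 ^ k
  v = χ A k
  ballots = map (λ n → pair n v) xs
  D⊆Gra : ∀ y → InD ⌜ ballots ⌝ y → Gra g y
  D⊆Gra y y∈D with ∈-map⁻ (λ n → pair n v) (InD⌜⌝⁻ ballots {y} y∈D)
  ... | n , n∈xs , y≡n,v = n , v , y≡n,v , subst (rel g n) (χ-Rt-J A (All.lookup inJ n∈xs)) (All.lookup described n∈xs)
  𝟙≤bit : ∀ i → 𝟙 (K + i ∈? xs) ≤ bit ⌜ ballots ⌝ (pair (K + i) v)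
  𝟙≤bit i with K + i ∈? xs
  ... | no _        = z≤n
  ... | yes K+i∈xs  = ≤-reflexive (sym (InD⌜⌝⁺ ballots (∈-map⁺ (λ n → pair n v) K+i∈xs)))
  length≤votes : length xs ≤ votes ⌜ ballots ⌝ k v K
  length≤votes = ≤-trans (length≤sumBelow-𝟙∈ K K unique inJ) (sumBelow-mono-≤ K 𝟙≤bit)

DenseDesc⇒WeakCofDesc : ∀ A g → DenseDesc g (χ (Rt A)) → WeakCofDesc (electionᴾ g) (χ A)
DenseDesc⇒WeakCofDesc A g dense =
  let N , majority = densityOne⇒majority dense
  in N , λ k N≤k → Majority⇒Elected A g k (majority k N≤k)

lemma5p1 :
    -- (1) enumeration operators
    (Σ (Code false 1) λ W → (A : SetΩ) (f : Partial) → WeakCofDesc f (χ A) →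
       Σ Partial λ d → ((x : ℕ) → EnumOp W (Gra f) x ⇔ Gra d x) × DenseDesc d (χ (Rt A)))
    × (Σ (Code false 1) λ V → (A : SetΩ) (g : Partial) → DenseDesc g (χ (Rt A)) →
       Σ Partial λ d → ((x : ℕ) → EnumOp V (Gra g) x ⇔ Gra d x) × WeakCofDesc d (χ A))
    -- (2) Turing functionals
    × (Σ (Code true 1) λ Φ → (A : SetΩ) (f : ℕ → Maybe ℕ) → StrongCofDesc f (χ A) →
       Σ (ℕ → Maybe ℕ) λ d → Computes Φ f d × EffDenseDesc d (χ (Rt A)))
    × (Σ (Code true 1) λ Ψ → (A : SetΩ) (g : ℕ → Maybe ℕ) → EffDenseDesc g (χ (Rt A)) →
       Σ (ℕ → Maybe ℕ) λ d → Computes Ψ g d × StrongCofDesc d (χ A))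
lemma5p1 =
    (Wᶜ , λ A f f-describes → spreadᴾ f , EnumOp-Wᶜ f , WeakCofDesc⇒DenseDesc A f f-describes)
  , (Vᶜ , λ A g g-describes → electionᴾ g , EnumOp-Vᶜ g , DenseDesc⇒WeakCofDesc A g g-describes)
  , (Φᶜ , λ A f f-describes → spread nothing f , eval-Φᶜ f , StrongCofDesc⇒EffDenseDesc A f f-describes)
  , (Ψᶜ , λ A g g-describes → (λ k → scan g k (2 ^ k)) , eval-Ψᶜ g , EffDenseDesc⇒StrongCofDesc A g g-describes)
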